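{- For every finite simple graph $G$, the following statements are equivalent: (1) $G$ is a threshold graph; (2) the clique hypergraph $\mathcal{C}(G)$ is $1$-Sperner; (3) the clique hypergraph $\mathcal{C}(G)$ is threshold; (4) the clique hypergraph $\mathcal{C}(G)$ is $2$-asummable.
   Context: A hypergraph $\mathcal{H}=(V,E)$ consists of a finite vertex set $V$ and a set $E$ of subsets of $V$ (hyperedges). $\mathcal{H}$ is $1$-Sperner if every two distinct hyperedges $e,f$ satisfy $\min\{|e\setminus f|,|f\setminus e|\}=1$. A set $X\subseteq V$ is independent in $\mathcal{H}$ if it contains no hyperedge, and dependent otherwise. $\mathcal{H}$ is threshold if there exist $w:V\to\mathbb{Z}_{\ge0}$ and $t\in\mathbb{Z}_{\ge0}$ such that for every $X\subseteq V$, $\sum_{x\in X}w(x)\ge t$ if and only if $X$ contains some hyperedge. $\mathcal{H}$ is $2$-asummable if there are no (not necessarily distinct) independent sets $A_1,A_2$ and dependent sets $B_1,B_2$ with $\chi^{A_1}+\chi^{A_2}=\chi^{B_1}+\chi^{B_2}$, where $\chi^S\in\{0,1\}^V$ is the characteristic vector of $S$. A graph $G=(V,E)$ is threshold if there exist $w:V\to\mathbb{Z}_{\ge0}$ and $t\in\mathbb{Z}_{\ge0}$ such that for every $X\subseteq V$, $\sum_{x\in X}w(x)\le t$ if and only if $X$ is an independent set of $G$. The clique hypergraph $\mathcal{C}(G)$ has vertex set $V(G)$ and as hyperedges exactly the inclusion-maximal cliques of $G$. -}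

module Defs where

open import Data.Nat using (ℕ; _+_; _≤_; _≥_; _⊓_)
open import Data.Bool using (Bool; true; false; if_then_else_)
open import Data.Fin using (Fin)
open import Data.Fin.Subset using (Subset; _∈_; _⊆_; _─_; ∣_∣)
open import Data.Vec using (lookup)
open import Data.Vec.Functional using (foldr)
open import Data.Product using (Σ; _×_; ∃-syntax)
open import Relation.Binary.PropositionalEquality using (_≡_; _≢_)
open import Relation.Nullary using (¬_)
open import Function.Bundles using (_⇔_)

record Graph (n : ℕ) : Set where
  field
    adj   : Fin n → Fin n → Bool
    sym   : ∀ i j → adj i j ≡ adj j i
    irref : ∀ i → adj i i ≡ false
open Graph public

Hypergraph : ℕ → Set₁
Hypergraph n = Subset n → Set

wsum : ∀ {n} → (Fin n → ℕ) → Subset n → ℕ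
wsum w X = foldr _+_ 0 (λ i → if lookup X i then w i else 0)

χ : ∀ {n} → Subset n → Fin n → ℕ
χ X i = if lookup X i then 1 else 0

IsClique : ∀ {n} → Graph n → Subset n → Set
IsClique G X = ∀ i j → i ∈ X → j ∈ X → i ≢ j → adj G i j ≡ true

IsIndependentG : ∀ {n} → Graph n → Subset n → Set
IsIndependentG G X = ∀ i j → i ∈ X → j ∈ X → adj G i j ≡ false

IsThresholdGraph : ∀ {n} → Graph n → Set
IsThresholdGraph {n} G =
  Σ (Fin n → ℕ) λ w → Σ ℕ λ t →
    ∀ (X : Subset n) → (wsum w X ≤ t) ⇔ IsIndependentG G X

IsMaximalClique : ∀ {n} → Graph n → Subset n → Set
IsMaximalClique {n} G X =
  IsClique G X × (∀ (Y : Subset n) → IsClique G Y → X ⊆ Y → Y ⊆ X)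

cliqueHypergraph : ∀ {n} → Graph n → Hypergraph n
cliqueHypergraph G = IsMaximalClique G

Dependent : ∀ {n} → Hypergraph n → Subset n → Set
Dependent H X = ∃[ e ] (H e × e ⊆ X)

Independent : ∀ {n} → Hypergraph n → Subset n → Set
Independent H X = ¬ Dependent H X

Is1Sperner : ∀ {n} → Hypergraph n → Set
Is1Sperner H = ∀ e f → H e → H f → e ≢ f → (∣ e ─ f ∣ ⊓ ∣ f ─ e ∣) ≡ 1

IsThresholdHypergraph : ∀ {n} → Hypergraph n → Set
IsThresholdHypergraph {n} H =
  Σ (Fin n → ℕ) λ w → Σ ℕ λ t →
    ∀ (X : Subset n) → (wsum w X ≥ t) ⇔ Dependent H X

Is2Asummable : ∀ {n} → Hypergraph n → Set
Is2Asummable {n} H =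
  ∀ (A₁ A₂ B₁ B₂ : Subset n) →
    Independent H A₁ → Independent H A₂ →
    Dependent H B₁ → Dependent H B₂ →
    ¬ (∀ i → χ A₁ i + χ A₂ i ≡ χ B₁ i + χ B₂ i)

-- Each statement is shown equivalent to: G has no alternating 4-cycle
-- (edges ab, cd and non-edges ac, bd).
-- * (1) ⇒ no cycle, and (3) ⇒ (4) for any hypergraph: weights cannot
--   separate two families with the same multiset union.
-- * No cycle ⇒ (1), (3): neighbourhoods are nested, so every nonempty
--   vertex set has an isolated or a dominating vertex; weights are built by
--   induction along such an elimination of vertices.
-- * (2) ⇔ no cycle, (4) ⇒ no cycle: the edges of a cycle extend to maximal
--   cliques e, f each with two vertices outside the other; conversely such
--   private pairs force a cycle, and for (4) e + f is rearranged into two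
--   independent sets.
module Submission where

open import Defs renaming (sym to adj-sym)
open import Data.Nat using (ℕ; zero; suc; _+_; _*_; _≤_; _<_; z≤n; s≤s; _⊓_)
open import Data.Nat.Properties
  using ( ≤-refl; ≤-trans; ≤-antisym; ≤-reflexive; ≤-pred; ⊓-glb; m⊓n≤m; m⊓n≤n
        ; +-identityʳ; *-distribʳ-+; +-mono-≤; +-monoʳ-≤; +-mono-<; m≤m+n; m≤n+m
        ; <-irrefl; <-≤-trans; ≮⇒≥; n≮n; n<1+n; +-suc; ≰⇒>; m<m+n; +-cancelˡ-≤; +-comm
        ; module ≤-Reasoning; +-0-commutativeMonoid; +-commutativeSemigroup)
open import Data.Bool using (Bool; true; false; _∧_; _∨_; not; if_then_else_)
open import Data.Bool.Properties using (¬-not) renaming (_≟_ to _≟ᵇ_)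
open import Data.Fin using (Fin; zero; suc; _≟_)
open import Data.Fin.Properties using (all?; any?; ¬∀⟶∃¬)
open import Data.Fin.Subset
  using (Subset; _∈_; _∉_; _⊆_; _─_; _-_; _∪_; _∩_; ∁; ⁅_⁆; ∣_∣; Nonempty; Empty)
  renaming (⊥ to ∅; ⊤ to full)
open import Data.Fin.Subset.Properties
  using ( _∈?_; nonempty?; Empty-unique; ⊆-refl; ⊆-antisym; drop-∷-⊆
        ; ∈⊤; ∉⊥; x∈⁅x⁆; x∈⁅y⁆⇒x≡y; ∣⁅x⁆∣≡1; p⊆q⇒∣p∣≤∣q∣; x∈p⇒∣p-x∣<∣p∣
        ; x∈p∪q⁻; x∈∁p⇒x∉p; p⊆p∪q; q⊆p∪q; x∈p∩q⁻; p─q⊆p; x∈p∧x≢y⇒x∈p-y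
        ; x∈p∧x∉q⇒x∈p─q; p─⊥≡p)
open import Data.Vec using ([]; _∷_; here; there; lookup; tabulate)
open import Data.Vec.Properties
  using (lookup-zipWith; lookup-map; lookup∘tabulate; []=⇒lookup; lookup⇒[]=)
open import Data.Vec.Functional using (updateAt)
open import Data.Vec.Functional.Properties using (updateAt-updates; updateAt-minimal)
open import Data.Product using (_×_; _,_; proj₁; proj₂; ∃)
open import Data.Sum using (_⊎_; inj₁; inj₂; [_,_]′)
open import Data.Empty using (⊥; ⊥-elim)
open import Function using (_∘_; const)
open import Function.Bundles using (_⇔_; mk⇔; Equivalence)
open import Relation.Binary.PropositionalEquality
open import Relation.Nullary using (¬_; Dec; yes; no; contradiction)
open import Relation.Nullary.Decidable using (_×-dec_; _→-dec_; ¬?)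
open import Algebra.Properties.CommutativeMonoid.Sum +-0-commutativeMonoid
  using (sum; sum-cong-≗; ∑-distrib-+)
open import Algebra.Properties.CommutativeSemigroup +-commutativeSemigroup
  using (interchange; x∙yz≈y∙xz)

private
  variable
    n : ℕ
    A B : Set

failed-implication : Dec A → ¬ (A → B) → A × ¬ B
failed-implication (yes a) ¬a→b = a , λ b → ¬a→b (λ _ → b)
failed-implication (no ¬a) ¬a→b = contradiction (λ a → contradiction a ¬a) ¬a→b

avoid : ∀ {P : Fin n → Set} {c d} → P c → P d → c ≢ d → ∀ x → ∃ λ z → P z × z ≢ x
avoid {c = c} {d} Pc Pd c≢d x with c ≟ x
... | yes refl = d , Pd , c≢d ∘ sym
... | no c≢x   = c , Pc , c≢x

∈⇒lookup : ∀ {i} {p : Subset n} → i ∈ p → lookup p i ≡ true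
∈⇒lookup = []=⇒lookup

lookup⇒∈ : ∀ {i} {p : Subset n} → lookup p i ≡ true → i ∈ p
lookup⇒∈ {i = i} {p} = lookup⇒[]= i p

∉⇒lookup : ∀ {i} {p : Subset n} → i ∉ p → lookup p i ≡ false
∉⇒lookup i∉p = ¬-not (i∉p ∘ lookup⇒∈)

∈-tabulate⁻ : ∀ {f : Fin n → Bool} {i} → i ∈ tabulate f → f i ≡ true
∈-tabulate⁻ {f = f} {i} i∈ = trans (sym (lookup∘tabulate f i)) (∈⇒lookup i∈)

∈-tabulate⁺ : ∀ {f : Fin n → Bool} {i} → f i ≡ true → i ∈ tabulate f
∈-tabulate⁺ {f = f} {i} fi = lookup⇒∈ (trans (lookup∘tabulate f i) fi)

x∈p─q⇒x∉q : ∀ {p q : Subset n} {x} → x ∈ p ─ q → x ∉ q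
x∈p─q⇒x∉q {p = _ ∷ _} {true  ∷ _} {zero}  ()
x∈p─q⇒x∉q {p = _ ∷ _} {false ∷ _} {zero}  _          ()
x∈p─q⇒x∉q {p = _ ∷ _} {_ ∷ _}     {suc x} (there x∈) (there x∈q) = x∈p─q⇒x∉q x∈ x∈q

∈-remove⁻ : ∀ {p : Subset n} {x y} → x ∈ p - y → x ∈ p × x ≢ y
∈-remove⁻ {p = p} {y = y} x∈ = p─q⊆p p ⁅ y ⁆ x∈ , λ { refl → x∈p─q⇒x∉q x∈ (x∈⁅x⁆ y) }

remove-mono : ∀ {X S : Subset n} {v} → X ⊆ S → X - v ⊆ S - v
remove-mono X⊆S x∈ = let x∈X , x≢v = ∈-remove⁻ x∈ in x∈p∧x≢y⇒x∈p-y (X⊆S x∈X) x≢v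

⊆-remove : ∀ {X : Subset n} {v} → v ∉ X → X ⊆ X - v
⊆-remove v∉X x∈X = x∈p∧x≢y⇒x∈p-y x∈X λ { refl → v∉X x∈X }

∈-or-removed : ∀ {p : Subset n} {z} x → z ∈ p → z ≡ x ⊎ z ∈ p - x
∈-or-removed {z = z} x z∈p with z ≟ x
... | yes z≡x = inj₁ z≡x
... | no z≢x  = inj₂ (x∈p∧x≢y⇒x∈p-y z∈p z≢x)

∈-insert⁻ : ∀ {p : Subset n} {x v} → x ∈ p ∪ ⁅ v ⁆ → x ∈ p ⊎ x ≡ v
∈-insert⁻ {p = p} {v = v} x∈ with x∈p∪q⁻ p ⁅ v ⁆ x∈
... | inj₁ x∈p = inj₁ x∈p
... | inj₂ x∈v = inj₂ (x∈⁅y⁆⇒x≡y v x∈v)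

∈-insert : ∀ {p : Subset n} v → v ∈ p ∪ ⁅ v ⁆
∈-insert {p = p} v = q⊆p∪q p ⁅ v ⁆ (x∈⁅x⁆ v)

∈-pair⁻ : ∀ {a b x : Fin n} → x ∈ ⁅ a ⁆ ∪ ⁅ b ⁆ → x ≡ a ⊎ x ≡ b
∈-pair⁻ {a = a} x∈ with ∈-insert⁻ x∈
... | inj₁ x∈a  = inj₁ (x∈⁅y⁆⇒x≡y a x∈a)
... | inj₂ x≡b = inj₂ x≡b

⊆-or-outside : ∀ (p q : Subset n) → p ⊆ q ⊎ ∃ λ x → x ∈ p × x ∉ q
⊆-or-outside p q with all? (λ x → x ∈? p →-dec x ∈? q)
... | yes p⊆q = inj₁ (p⊆q _)
... | no p⊈q  = let x , bad = ¬∀⟶∃¬ _ _ (λ x → x ∈? p →-dec x ∈? q) p⊈q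
                in inj₂ (x , failed-implication (x ∈? p) bad)

⁅⁆⊆ : ∀ {X : Subset n} {v} → v ∈ X → ⁅ v ⁆ ⊆ X
⁅⁆⊆ {X = X} {v} v∈X y∈⁅v⁆ = subst (_∈ X) (sym (x∈⁅y⁆⇒x≡y v y∈⁅v⁆)) v∈X

removed-empty : ∀ {p : Subset n} {x} → Empty (p - x) → p ⊆ ⁅ x ⁆
removed-empty {x = x} p-x-empty y∈p with ∈-or-removed x y∈p
... | inj₁ refl    = x∈⁅x⁆ x
... | inj₂ y∈p-x = contradiction (_ , y∈p-x) p-x-empty

∈⇒1≤∣∣ : ∀ {p : Subset n} {x} → x ∈ p → 1 ≤ ∣ p ∣
∈⇒1≤∣∣ {p = p} {x} x∈p = subst (_≤ ∣ p ∣) (∣⁅x⁆∣≡1 x) (p⊆q⇒∣p∣≤∣q∣ (⁅⁆⊆ x∈p))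

two⇒2≤∣∣ : ∀ {p : Subset n} {x y} → x ∈ p → y ∈ p → x ≢ y → 2 ≤ ∣ p ∣
two⇒2≤∣∣ x∈p y∈p x≢y =
  ≤-trans (s≤s (∈⇒1≤∣∣ (x∈p∧x≢y⇒x∈p-y y∈p (x≢y ∘ sym)))) (x∈p⇒∣p-x∣<∣p∣ x∈p)

at-most-one-or-two : ∀ {p : Subset n} {x} → x ∈ p → ∣ p ∣ ≤ 1 ⊎ ∃ λ y → y ∈ p × y ≢ x
at-most-one-or-two {p = p} {x} x∈p with nonempty? (p - x)
... | yes (y , y∈p-x) = inj₂ (y , ∈-remove⁻ y∈p-x)
... | no p-x-empty    = inj₁ (subst (∣ p ∣ ≤_) (∣⁅x⁆∣≡1 x) (p⊆q⇒∣p∣≤∣q∣ (removed-empty p-x-empty)))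

min-is-one : ∀ {a b} → 1 ≤ a → 1 ≤ b → a ≤ 1 ⊎ b ≤ 1 → a ⊓ b ≡ 1
min-is-one {a} {b} 1≤a 1≤b small = ≤-antisym (min≤1 small) (⊓-glb 1≤a 1≤b)
  where
  min≤1 : a ≤ 1 ⊎ b ≤ 1 → a ⊓ b ≤ 1
  min≤1 (inj₁ a≤1) = ≤-trans (m⊓n≤m a b) a≤1
  min≤1 (inj₂ b≤1) = ≤-trans (m⊓n≤n a b) b≤1

ind : Bool → ℕ
ind b = if b then 1 else 0

ind≤1 : ∀ b → ind b ≤ 1
ind≤1 true  = ≤-refl
ind≤1 false = z≤n

lookup-─ : ∀ (p q : Subset n) i → lookup (p ─ q) i ≡ lookup p i ∧ not (lookup q i)
lookup-─ (true  ∷ p) (true  ∷ q) zero    = refl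
lookup-─ (false ∷ p) (true  ∷ q) zero    = refl
lookup-─ (true  ∷ p) (false ∷ q) zero    = refl
lookup-─ (false ∷ p) (false ∷ q) zero    = refl
lookup-─ (_ ∷ p)     (_ ∷ q)     (suc i) = lookup-─ p q i

lookup-∪ : ∀ (p q : Subset n) i → lookup (p ∪ q) i ≡ lookup p i ∨ lookup q i
lookup-∪ p q i = lookup-zipWith _∨_ i p q

lookup-∩ : ∀ (p q : Subset n) i → lookup (p ∩ q) i ≡ lookup p i ∧ lookup q i
lookup-∩ p q i = lookup-zipWith _∧_ i p q

lookup-∁ : ∀ (p : Subset n) i → lookup (∁ p) i ≡ not (lookup p i)
lookup-∁ p i = lookup-map i not p

χ-modular : ∀ (p q : Subset n) i → χ (p ∪ q) i + χ (p ∩ q) i ≡ χ p i + χ q i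
χ-modular p q i = trans (cong₂ _+_ (cong ind (lookup-∪ p q i)) (cong ind (lookup-∩ p q i)))
                        (modular (lookup p i) (lookup q i))
  where
  modular : ∀ x y → ind (x ∨ y) + ind (x ∧ y) ≡ ind x + ind y
  modular true  true  = refl
  modular true  false = refl
  modular false true  = refl
  modular false false = refl

χ-disjoint-∪ : ∀ (p q : Subset n) → (∀ {i} → i ∈ p → i ∉ q) → ∀ i → χ (p ∪ q) i ≡ χ p i + χ q i
χ-disjoint-∪ p q disjoint i =
  trans (cong ind (lookup-∪ p q i))
        (disjoint-sum (lookup p i) (lookup q i) (∉⇒lookup ∘ disjoint ∘ lookup⇒∈))
  where
  disjoint-sum : ∀ x y → (x ≡ true → y ≡ false) → ind (x ∨ y) ≡ ind x + ind y
  disjoint-sum true  true  x→¬y = contradiction (x→¬y refl) λ ()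
  disjoint-sum true  false _    = refl
  disjoint-sum false y     _    = refl

χ-split : ∀ (e f N : Subset n) i → χ (e ∪ (f ∩ N)) i + χ (f ∩ (e ∪ ∁ N)) i ≡ χ e i + χ f i
χ-split e f N i = trans (cong₂ _+_ (cong ind in-U) (cong ind in-I))
                        (redistribute (lookup e i) (lookup f i) (lookup N i))
  where
  in-U : lookup (e ∪ (f ∩ N)) i ≡ lookup e i ∨ (lookup f i ∧ lookup N i)
  in-U = trans (lookup-∪ e _ i) (cong (lookup e i ∨_) (lookup-∩ f N i))
  in-I : lookup (f ∩ (e ∪ ∁ N)) i ≡ lookup f i ∧ (lookup e i ∨ not (lookup N i))
  in-I = trans (lookup-∩ f _ i)
               (cong (lookup f i ∧_) (trans (lookup-∪ e _ i) (cong (lookup e i ∨_) (lookup-∁ N i))))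
  redistribute : ∀ x y a → ind (x ∨ (y ∧ a)) + ind (y ∧ (x ∨ not a)) ≡ ind x + ind y
  redistribute true  true  _     = refl
  redistribute true  false _     = refl
  redistribute false true  true  = refl
  redistribute false true  false = refl
  redistribute false false _     = refl

χ-exchange : ∀ (U I D : Subset n) → D ⊆ U → (∀ {i} → i ∈ D → i ∉ I) →
             ∀ i → χ (U ─ D) i + χ (I ∪ D) i ≡ χ U i + χ I i
χ-exchange U I D D⊆U D∩I=∅ i =
  trans (cong₂ _+_ (cong ind (lookup-─ U D i)) (cong ind (lookup-∪ I D i)))
        (exchange (lookup U i) (lookup I i) (lookup D i)
                  (∈⇒lookup ∘ D⊆U ∘ lookup⇒∈) (∉⇒lookup ∘ D∩I=∅ ∘ lookup⇒∈))
  where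
  exchange : ∀ u x d → (d ≡ true → u ≡ true) → (d ≡ true → x ≡ false) →
             ind (u ∧ not d) + ind (x ∨ d) ≡ ind u + ind x
  exchange u     true  true  _   d→¬x = contradiction (d→¬x refl) λ ()
  exchange false x     true  d→u _    = contradiction (d→u refl) λ ()
  exchange true  false true  _   _    = refl
  exchange true  true  false _   _    = refl
  exchange true  false false _   _    = refl
  exchange false true  false _   _    = refl
  exchange false false false _   _    = refl

half-bound : ∀ {s t} → s + s ≤ suc (t + t) → s ≤ t
half-bound {s} {t} s+s≤ = ≮⇒≥ λ t<s → n≮n (suc (t + t)) (begin-strict
  suc (t + t)       <⟨ n<1+n _ ⟩
  suc (suc (t + t)) ≡⟨ cong suc (+-suc t t) ⟨
  suc t + suc t     ≤⟨ +-mono-≤ t<s t<s ⟩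
  s + s             ≤⟨ s+s≤ ⟩
  suc (t + t)       ∎)
  where open ≤-Reasoning

wsum-χ : ∀ (w : Fin n → ℕ) X → wsum w X ≡ sum (λ i → χ X i * w i)
wsum-χ w X = sum-cong-≗ λ i → term (lookup X i) (w i)
  where
  term : ∀ b k → (if b then k else 0) ≡ ind b * k
  term true  k = sym (+-identityʳ k)
  term false k = refl

wsum-exchange : ∀ (w : Fin n → ℕ) (A₁ A₂ B₁ B₂ : Subset n) →
                (∀ i → χ A₁ i + χ A₂ i ≡ χ B₁ i + χ B₂ i) →
                wsum w A₁ + wsum w A₂ ≡ wsum w B₁ + wsum w B₂
wsum-exchange w A₁ A₂ B₁ B₂ same = begin
  wsum w A₁ + wsum w A₂
    ≡⟨ cong₂ _+_ (wsum-χ w A₁) (wsum-χ w A₂) ⟩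
  sum (λ i → χ A₁ i * w i) + sum (λ i → χ A₂ i * w i)
    ≡⟨ ∑-distrib-+ (λ i → χ A₁ i * w i) (λ i → χ A₂ i * w i) ⟨
  sum (λ i → χ A₁ i * w i + χ A₂ i * w i)
    ≡⟨ sum-cong-≗ pointwise ⟩
  sum (λ i → χ B₁ i * w i + χ B₂ i * w i)
    ≡⟨ ∑-distrib-+ (λ i → χ B₁ i * w i) (λ i → χ B₂ i * w i) ⟩
  sum (λ i → χ B₁ i * w i) + sum (λ i → χ B₂ i * w i)
    ≡⟨ cong₂ _+_ (wsum-χ w B₁) (wsum-χ w B₂) ⟨
  wsum w B₁ + wsum w B₂ ∎
  where
  open ≡-Reasoning
  pointwise : ∀ i → χ A₁ i * w i + χ A₂ i * w i ≡ χ B₁ i * w i + χ B₂ i * w i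
  pointwise i = begin
    χ A₁ i * w i + χ A₂ i * w i ≡⟨ *-distribʳ-+ (w i) (χ A₁ i) (χ A₂ i) ⟨
    (χ A₁ i + χ A₂ i) * w i     ≡⟨ cong (_* w i) (same i) ⟩
    (χ B₁ i + χ B₂ i) * w i     ≡⟨ *-distribʳ-+ (w i) (χ B₁ i) (χ B₂ i) ⟩
    χ B₁ i * w i + χ B₂ i * w i ∎

wsum-+ : ∀ (w₁ w₂ : Fin n → ℕ) X → wsum (λ i → w₁ i + w₂ i) X ≡ wsum w₁ X + wsum w₂ X
wsum-+ w₁ w₂ X = trans (sum-cong-≗ λ i → split (lookup X i))
  (∑-distrib-+ (λ i → if lookup X i then w₁ i else 0) (λ i → if lookup X i then w₂ i else 0))
  where
  split : ∀ {a c} b → (if b then a + c else 0) ≡ (if b then a else 0) + (if b then c else 0)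
  split true  = refl
  split false = refl

wsum-cong : ∀ {w₁ w₂ : Fin n → ℕ} X → (∀ {i} → i ∈ X → w₁ i ≡ w₂ i) → wsum w₁ X ≡ wsum w₂ X
wsum-cong {w₁ = w₁} {w₂} X agree = sum-cong-≗ pointwise
  where
  pointwise : ∀ i → (if lookup X i then w₁ i else 0) ≡ (if lookup X i then w₂ i else 0)
  pointwise i with lookup X i in X∋i
  ... | true  = agree (lookup⇒∈ X∋i)
  ... | false = refl

wsum-remove : ∀ (w : Fin n → ℕ) X v → wsum w X ≡ (if lookup X v then w v else 0) + wsum w (X - v)
wsum-remove w (x ∷ X) zero    =
  cong (λ Y → (if x then w zero else 0) + wsum (w ∘ suc) Y) (sym (p─⊥≡p X))
wsum-remove w (x ∷ X) (suc v) =
  trans (cong ((if x then w zero else 0) +_) (wsum-remove (w ∘ suc) X v))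
        (x∙yz≈y∙xz (if x then w zero else 0) _ (wsum (w ∘ suc) (X - v)))

wsum-update : ∀ (w : Fin n → ℕ) α X v →
              wsum (updateAt w v (const α)) X ≡ (if lookup X v then α else 0) + wsum w (X - v)
wsum-update w α X v = trans (wsum-remove (updateAt w v (const α)) X v) (cong₂ _+_
  (cong (λ k → if lookup X v then k else 0) (updateAt-updates v w))
  (wsum-cong (X - v) λ i∈ → updateAt-minimal _ v w (proj₂ (∈-remove⁻ i∈))))

wsum-update-∈ : ∀ (w : Fin n → ℕ) α {X v} → v ∈ X →
                wsum (updateAt w v (const α)) X ≡ α + wsum w (X - v)
wsum-update-∈ w α {X} {v} v∈X =
  trans (wsum-update w α X v) (cong (λ b → (if b then α else 0) + wsum w (X - v)) (∈⇒lookup v∈X))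

wsum-update-∉ : ∀ (w : Fin n → ℕ) α {X v} → v ∉ X →
                wsum (updateAt w v (const α)) X ≡ wsum w (X - v)
wsum-update-∉ w α {X} {v} v∉X =
  trans (wsum-update w α X v) (cong (λ b → (if b then α else 0) + wsum w (X - v)) (∉⇒lookup v∉X))

wsum-mono : ∀ (w : Fin n → ℕ) {X Y : Subset n} → X ⊆ Y → wsum w X ≤ wsum w Y
wsum-mono w {[]}        {[]}    _   = z≤n
wsum-mono w {true ∷ X}  {y ∷ Y} X⊆Y rewrite ∈⇒lookup {p = y ∷ Y} (X⊆Y here) =
  +-monoʳ-≤ (w zero) (wsum-mono (w ∘ suc) (drop-∷-⊆ X⊆Y))
wsum-mono w {false ∷ X} {y ∷ Y} X⊆Y =
  ≤-trans (wsum-mono (w ∘ suc) (drop-∷-⊆ X⊆Y)) (m≤n+m _ _)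

wsum-∅ : ∀ (w : Fin n → ℕ) → wsum w ∅ ≡ 0
wsum-∅ {zero}  w = refl
wsum-∅ {suc n} w = wsum-∅ (w ∘ suc)

wsum-empty : ∀ (w : Fin n → ℕ) {X} → Empty X → wsum w X ≡ 0
wsum-empty w X-empty rewrite Empty-unique X-empty = wsum-∅ w

positive⇒nonempty : ∀ (w : Fin n → ℕ) {X} → 1 ≤ wsum w X → Nonempty X
positive⇒nonempty w {X} 1≤wX with nonempty? X
... | yes X-nonempty = X-nonempty
... | no X-empty     = contradiction (subst (1 ≤_) (wsum-empty w X-empty) 1≤wX) λ ()

∈⇒≤wsum : ∀ (w : Fin n → ℕ) {X i} → i ∈ X → w i ≤ wsum w X
∈⇒≤wsum w {X} {i} i∈X = begin
  w i                  ≤⟨ m≤m+n (w i) _ ⟩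
  w i + wsum w (X - i) ≡⟨ cong (λ b → (if b then w i else 0) + wsum w (X - i)) (∈⇒lookup i∈X) ⟨
  _                    ≡⟨ wsum-remove w X i ⟨
  wsum w X             ∎
  where open ≤-Reasoning

separated-exchange : ∀ (w : Fin n → ℕ) {t} (A₁ A₂ B₁ B₂ : Subset n) →
                     (∀ i → χ A₁ i + χ A₂ i ≡ χ B₁ i + χ B₂ i) →
                     wsum w A₁ < t → wsum w A₂ < t → t ≤ wsum w B₁ → t ≤ wsum w B₂ → ⊥
separated-exchange w {t} A₁ A₂ B₁ B₂ same A₁<t A₂<t t≤B₁ t≤B₂ =
  <-irrefl (wsum-exchange w A₁ A₂ B₁ B₂ same) (begin-strict
    wsum w A₁ + wsum w A₂ <⟨ +-mono-< A₁<t A₂<t ⟩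
    t + t                 ≤⟨ +-mono-≤ t≤B₁ t≤B₂ ⟩
    wsum w B₁ + wsum w B₂ ∎)
  where open ≤-Reasoning

-- (3) ⇒ (4) for every hypergraph.

threshold⇒2-asummable : ∀ (H : Hypergraph n) → IsThresholdHypergraph H → Is2Asummable H
threshold⇒2-asummable H (w , t , separates) A₁ A₂ B₁ B₂ A₁-ind A₂-ind B₁-dep B₂-dep same =
  separated-exchange w A₁ A₂ B₁ B₂ same (light A₁-ind) (light A₂-ind)
    (Equivalence.from (separates B₁) B₁-dep) (Equivalence.from (separates B₂) B₂-dep)
  where
  light : ∀ {A} → Independent H A → wsum w A < t
  light {A} A-ind = ≰⇒> (A-ind ∘ Equivalence.to (separates A))

removal-induction : (P : Subset n → Set) → (∀ S → (∀ {x} → x ∈ S → P (S - x)) → P S) →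
                    ∀ S → P S
removal-induction P step S = go (suc ∣ S ∣) S ≤-refl
  where
  go : ∀ k S → ∣ S ∣ < k → P S
  go zero    S ()
  go (suc k) S ∣S∣<1+k = step S λ x∈S →
    go k _ (<-≤-trans (x∈p⇒∣p-x∣<∣p∣ x∈S) (≤-pred ∣S∣<1+k))

greatest : ∀ (R : Fin n → Fin n → Set) (U : Subset n) →
           (∀ {x y} → x ∈ U → y ∈ U → R x y ⊎ R y x) →
           (∀ {x y z} → x ∈ U → y ∈ U → z ∈ U → R x y → R y z → R x z) →
           Nonempty U → ∃ λ m → m ∈ U × (∀ {z} → z ∈ U → R z m)
greatest {n = n} R U total transitive = removal-induction P step U ⊆-refl
  where
  P : Subset n → Set
  P T = T ⊆ U → Nonempty T → ∃ λ m → m ∈ T × (∀ {z} → z ∈ T → R z m)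

  reflexive : ∀ {x} → x ∈ U → R x x
  reflexive x∈U with total x∈U x∈U
  ... | inj₁ Rxx = Rxx
  ... | inj₂ Rxx = Rxx

  step : ∀ T → (∀ {x} → x ∈ T → P (T - x)) → P T
  step T IH T⊆U (x , x∈T) with nonempty? (T - x)
  ... | no T-x-empty = x , x∈T , below-x
    where
    below-x : ∀ {z} → z ∈ T → R z x
    below-x z∈T with ∈-or-removed x z∈T
    ... | inj₁ refl   = reflexive (T⊆U x∈T)
    ... | inj₂ z∈T-x  = contradiction (_ , z∈T-x) T-x-empty
  ... | yes T-x-nonempty with IH x∈T (T⊆U ∘ proj₁ ∘ ∈-remove⁻) T-x-nonempty
  ... | m , m∈T-x , below-m = larger (total (T⊆U x∈T) (T⊆U m∈T))
    where
    m∈T = proj₁ (∈-remove⁻ m∈T-x)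
    larger : R x m ⊎ R m x → ∃ λ m′ → m′ ∈ T × (∀ {z} → z ∈ T → R z m′)
    larger (inj₁ Rxm) = m , m∈T , λ z∈T → [ (λ { refl → Rxm }) , below-m ]′ (∈-or-removed x z∈T)
    larger (inj₂ Rmx) = x , x∈T , λ z∈T →
      [ (λ { refl → reflexive (T⊆U x∈T) })
      , (λ z∈T-x → transitive (T⊆U z∈T) (T⊆U m∈T) (T⊆U x∈T) (below-m z∈T-x) Rmx)
      ]′ (∈-or-removed x z∈T)

module _ {n : ℕ} (G : Graph n) where

  infix 4 _~_ _≁_ _~?_

  _~_ _≁_ : Fin n → Fin n → Set
  i ~ j = adj G i j ≡ true
  i ≁ j = adj G i j ≡ false

  _~?_ : ∀ i j → Dec (i ~ j)
  i ~? j = adj G i j ≟ᵇ true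

  ~-sym : ∀ {i j} → i ~ j → j ~ i
  ~-sym {i} {j} i~j = trans (adj-sym G j i) i~j

  ≁-sym : ∀ {i j} → i ≁ j → j ≁ i
  ≁-sym {i} {j} i≁j = trans (adj-sym G j i) i≁j

  ~⇒≢ : ∀ {i j} → i ~ j → i ≢ j
  ~⇒≢ {i} i~i refl = contradiction (trans (sym i~i) (irref G i)) λ ()

  ~⇒¬≁ : ∀ {i j} → i ~ j → ¬ i ≁ j
  ~⇒¬≁ i~j i≁j = contradiction (trans (sym i~j) i≁j) λ ()

  Dominating : Subset n → Fin n → Set
  Dominating K v = ∀ u → u ∈ K → u ≢ v → v ~ u

  Isolated : Subset n → Fin n → Set
  Isolated S v = ∀ u → u ∈ S → u ≢ v → v ≁ u

  dominates? : ∀ K v u → Dec (u ∈ K → u ≢ v → v ~ u)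
  dominates? K v u = u ∈? K →-dec ¬? (u ≟ v) →-dec v ~? u

  dominating? : ∀ K v → Dec (Dominating K v)
  dominating? K v = all? (dominates? K v)

  dominating-or-witness : ∀ K v → Dominating K v ⊎ ∃ λ u → u ∈ K × u ≢ v × v ≁ u
  dominating-or-witness K v with dominating? K v
  ... | yes dom = inj₁ dom
  ... | no ¬dom with ¬∀⟶∃¬ n _ (dominates? K v) ¬dom
  ... | u , fails with failed-implication (u ∈? K) fails
  ... | u∈K , fails′ with failed-implication (¬? (u ≟ v)) fails′
  ... | u≢v , ¬v~u = inj₂ (u , u∈K , u≢v , ¬-not ¬v~u)

  clique-insert : ∀ {K v} → IsClique G K → Dominating K v → IsClique G (K ∪ ⁅ v ⁆)
  clique-insert K-clique v-dom i j i∈ j∈ i≢j with ∈-insert⁻ i∈ | ∈-insert⁻ j∈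
  ... | inj₁ i∈K  | inj₁ j∈K  = K-clique i j i∈K j∈K i≢j
  ... | inj₂ refl | inj₁ j∈K  = v-dom j j∈K (i≢j ∘ sym)
  ... | inj₁ i∈K  | inj₂ refl = ~-sym (v-dom i i∈K i≢j)
  ... | inj₂ refl | inj₂ refl = contradiction refl i≢j

  singleton-clique : ∀ v → IsClique G ⁅ v ⁆
  singleton-clique v i j i∈ j∈ i≢j =
    contradiction (trans (x∈⁅y⁆⇒x≡y v i∈) (sym (x∈⁅y⁆⇒x≡y v j∈))) i≢j

  edge-clique : ∀ {a b} → a ~ b → IsClique G (⁅ a ⁆ ∪ ⁅ b ⁆)
  edge-clique {a} {b} a~b = clique-insert (singleton-clique a)
    λ u u∈⁅a⁆ _ → subst (b ~_) (sym (x∈⁅y⁆⇒x≡y a u∈⁅a⁆)) (~-sym a~b)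

  clique-excludes : ∀ {K u v} → IsClique G K → u ∈ K → v ≢ u → v ≁ u → v ∉ K
  clique-excludes K-clique u∈K v≢u v≁u v∈K = ~⇒¬≁ (K-clique _ _ v∈K u∈K v≢u) v≁u

  record MaximalCliqueIn (S K : Subset n) : Set where
    field
      within  : K ⊆ S
      clique  : IsClique G K
      maximal : ∀ {Y} → Y ⊆ S → IsClique G Y → K ⊆ Y → Y ⊆ K
  open MaximalCliqueIn

  global⇒full : ∀ {K} → IsMaximalClique G K → MaximalCliqueIn full K
  global⇒full (K-clique , K-max) = record
    { within = λ _ → ∈⊤ ; clique = K-clique ; maximal = λ {Y} _ → K-max Y }

  full⇒global : ∀ {K} → MaximalCliqueIn full K → IsMaximalClique G K
  full⇒global K-max = clique K-max , λ Y Y-clique → maximal K-max (λ _ → ∈⊤) Y-clique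

  absorb : ∀ {S K v} → MaximalCliqueIn S K → v ∈ S → Dominating K v → v ∈ K
  absorb {S} {K} {v} K-max v∈S v-dom =
    maximal K-max K∪v⊆S (clique-insert (clique K-max) v-dom) (p⊆p∪q ⁅ v ⁆) (∈-insert v)
    where
    K∪v⊆S : K ∪ ⁅ v ⁆ ⊆ S
    K∪v⊆S x∈ with ∈-insert⁻ x∈
    ... | inj₁ x∈K = within K-max x∈K
    ... | inj₂ refl = v∈S

  non-neighbour : ∀ {S K v} → MaximalCliqueIn S K → v ∈ S → v ∉ K →
                  ∃ λ u → u ∈ K × u ≢ v × v ≁ u
  non-neighbour {K = K} {v} K-max v∈S v∉K with dominating-or-witness K v
  ... | inj₁ v-dom  = contradiction (absorb K-max v∈S v-dom) v∉K
  ... | inj₂ witness = witness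

  empty-maximal : ∀ {S K} → MaximalCliqueIn S K → Empty K → Empty S
  empty-maximal K-max K-empty (v , v∈S) =
    K-empty (v , absorb K-max v∈S λ u u∈K _ → contradiction (u , u∈K) K-empty)

  restrict : ∀ {S T K} → MaximalCliqueIn S K → T ⊆ S → K ⊆ T → MaximalCliqueIn T K
  restrict K-max T⊆S K⊆T = record
    { within = K⊆T ; clique = clique K-max ; maximal = λ Y⊆T → maximal K-max (T⊆S ∘ Y⊆T) }

  -- Every clique extends to a maximal clique: keep adding a vertex
  -- adjacent to the whole clique while one exists; the set of
  -- candidates shrinks each time.
  extend : ∀ {K} → IsClique G K → ∃ λ F → IsMaximalClique G F × K ⊆ F
  extend {K} K-clique = removal-induction P step full K K-clique (λ _ → ∈⊤)
    where
    P : Subset n → Set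
    P C = ∀ K → IsClique G K → (∀ {x} → x ∉ K → x ∈ C) → ∃ λ F → IsMaximalClique G F × K ⊆ F

    step : ∀ C → (∀ {x} → x ∈ C → P (C - x)) → P C
    step C IH K K-clique outside∈C
      with any? (λ v → ¬? (v ∈? K) ×-dec dominating? K v)
    ... | yes (v , v∉K , v-dom) =
      let F , F-max , K∪v⊆F = IH (outside∈C v∉K) (K ∪ ⁅ v ⁆) (clique-insert K-clique v-dom) outside∈C-v
      in F , F-max , K∪v⊆F ∘ p⊆p∪q ⁅ v ⁆
      where
      outside∈C-v : ∀ {x} → x ∉ K ∪ ⁅ v ⁆ → x ∈ C - v
      outside∈C-v x∉ = x∈p∧x≢y⇒x∈p-y (outside∈C (x∉ ∘ p⊆p∪q ⁅ v ⁆)) λ { refl → x∉ (∈-insert v) }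
    ... | no none = K , (K-clique , K-max) , ⊆-refl
      where
      K-max : ∀ Y → IsClique G Y → K ⊆ Y → Y ⊆ K
      K-max Y Y-clique K⊆Y {y} y∈Y with y ∈? K
      ... | yes y∈K = y∈K
      ... | no y∉K  = contradiction
        (y , y∉K , λ u u∈K u≢y → Y-clique y u y∈Y (K⊆Y u∈K) (u≢y ∘ sym)) none

  NoAlternatingCycle : Set
  NoAlternatingCycle = ∀ {a b c d} → a ~ b → c ~ d → a ≁ c → b ≁ d → a ≢ c → b ≢ d → ⊥

  -- (1) ⇒ no alternating 4-cycle.

  pair-independent : ∀ {a c} → a ≁ c → IsIndependentG G (⁅ a ⁆ ∪ ⁅ c ⁆)
  pair-independent a≁c i j i∈ j∈ with ∈-pair⁻ i∈ | ∈-pair⁻ j∈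
  ... | inj₁ refl | inj₁ refl = irref G i
  ... | inj₁ refl | inj₂ refl = a≁c
  ... | inj₂ refl | inj₁ refl = ≁-sym a≁c
  ... | inj₂ refl | inj₂ refl = irref G i

  edge-dependent : ∀ {a b} → a ~ b → ¬ IsIndependentG G (⁅ a ⁆ ∪ ⁅ b ⁆)
  edge-dependent {a} {b} a~b independent =
    ~⇒¬≁ a~b (independent a b (p⊆p∪q ⁅ b ⁆ (x∈⁅x⁆ a)) (∈-insert b))

  -- The two edges and the two non-edges of an alternating 4-cycle cover
  -- the same vertices; the weights of a threshold graph put the edges
  -- above the bound and the non-edges below it.
  threshold⇒noAlternatingCycle : IsThresholdGraph G → NoAlternatingCycle
  threshold⇒noAlternatingCycle (w , t , separates) {a} {b} {c} {d} a~b c~d a≁c b≁d a≢c b≢d =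
    separated-exchange w {suc t} (⁅ a ⁆ ∪ ⁅ c ⁆) (⁅ b ⁆ ∪ ⁅ d ⁆) (⁅ a ⁆ ∪ ⁅ b ⁆) (⁅ c ⁆ ∪ ⁅ d ⁆)
      same-cover
      (s≤s (Equivalence.from (separates _) (pair-independent a≁c)))
      (s≤s (Equivalence.from (separates _) (pair-independent b≁d)))
      (≰⇒> (edge-dependent a~b ∘ Equivalence.to (separates _)))
      (≰⇒> (edge-dependent c~d ∘ Equivalence.to (separates _)))
    where
    χ-pair : ∀ {x y} → x ≢ y → ∀ i → χ (⁅ x ⁆ ∪ ⁅ y ⁆) i ≡ χ ⁅ x ⁆ i + χ ⁅ y ⁆ i
    χ-pair {x} {y} x≢y = χ-disjoint-∪ ⁅ x ⁆ ⁅ y ⁆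
      λ i∈x i∈y → x≢y (trans (sym (x∈⁅y⁆⇒x≡y x i∈x)) (x∈⁅y⁆⇒x≡y y i∈y))

    same-cover : ∀ i → χ (⁅ a ⁆ ∪ ⁅ c ⁆) i + χ (⁅ b ⁆ ∪ ⁅ d ⁆) i
                     ≡ χ (⁅ a ⁆ ∪ ⁅ b ⁆) i + χ (⁅ c ⁆ ∪ ⁅ d ⁆) i
    same-cover i = begin
      χ (⁅ a ⁆ ∪ ⁅ c ⁆) i + χ (⁅ b ⁆ ∪ ⁅ d ⁆) i
        ≡⟨ cong₂ _+_ (χ-pair a≢c i) (χ-pair b≢d i) ⟩
      (χ ⁅ a ⁆ i + χ ⁅ c ⁆ i) + (χ ⁅ b ⁆ i + χ ⁅ d ⁆ i)
        ≡⟨ interchange (χ ⁅ a ⁆ i) (χ ⁅ c ⁆ i) (χ ⁅ b ⁆ i) (χ ⁅ d ⁆ i) ⟩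
      (χ ⁅ a ⁆ i + χ ⁅ b ⁆ i) + (χ ⁅ c ⁆ i + χ ⁅ d ⁆ i)
        ≡⟨ cong₂ _+_ (χ-pair (~⇒≢ a~b) i) (χ-pair (~⇒≢ c~d) i) ⟨
      χ (⁅ a ⁆ ∪ ⁅ b ⁆) i + χ (⁅ c ⁆ ∪ ⁅ d ⁆) i ∎
      where open ≡-Reasoning

  -- No alternating 4-cycle ⇒ every nonempty vertex set has an isolated or
  -- a dominating vertex.

  NeighbourhoodBelow : Subset n → Fin n → Fin n → Set
  NeighbourhoodBelow S u z = ∀ y → y ∈ S → y ≢ u → y ≢ z → u ~ y → z ~ y

  below? : ∀ S u z y → Dec (y ∈ S → y ≢ u → y ≢ z → u ~ y → z ~ y)
  below? S u z y = y ∈? S →-dec ¬? (y ≟ u) →-dec ¬? (y ≟ z) →-dec u ~? y →-dec z ~? y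

  neighbourhoods-nested : NoAlternatingCycle → ∀ S u z →
                          NeighbourhoodBelow S u z ⊎ NeighbourhoodBelow S z u
  neighbourhoods-nested noAlt S u z with all? (below? S u z)
  ... | yes below = inj₁ below
  ... | no ¬below with ¬∀⟶∃¬ n _ (below? S u z) ¬below
  ... | y , f₁ with failed-implication (y ∈? S) f₁
  ... | _ , f₂ with failed-implication (¬? (y ≟ u)) f₂
  ... | _ , f₃ with failed-implication (¬? (y ≟ z)) f₃
  ... | y≢z , f₄ with failed-implication (u ~? y) f₄
  ... | u~y , ¬z~y = inj₂ λ y′ _ y′≢z y′≢u z~y′ → case-u~y′ y′ y′≢u z~y′
    where
    case-u~y′ : ∀ y′ → y′ ≢ u → z ~ y′ → u ~ y′
    case-u~y′ y′ y′≢u z~y′ with u ~? y′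
    ... | yes u~y′ = u~y′
    ... | no ¬u~y′ = ⊥-elim (noAlt u~y (~-sym z~y′) (¬-not ¬u~y′) (≁-sym (¬-not ¬z~y)) (y′≢u ∘ sym) y≢z)

  below-transitive : ∀ {S u z w} → u ∈ S → z ∈ S → w ∈ S →
                     NeighbourhoodBelow S u z → NeighbourhoodBelow S z w → NeighbourhoodBelow S u w
  below-transitive {S} {u} {z} {w} u∈S _ w∈S u≼z z≼w y y∈S y≢u y≢w u~y with y ≟ z
  ... | no y≢z   = z≼w y y∈S y≢z y≢w (u≼z y y∈S y≢u y≢z u~y)
  ... | yes refl with w ≟ u
  ...   | yes refl = u~y
  ...   | no w≢u   = ~-sym (u≼z w w∈S w≢u (y≢w ∘ sym) (~-sym w~u))
    where
    w~u : w ~ u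
    w~u = z≼w u u∈S (y≢u ∘ sym) (w≢u ∘ sym) (~-sym u~y)

  -- A vertex whose neighbourhood is greatest is dominating; otherwise
  -- any of its non-neighbours is isolated.
  eliminable : NoAlternatingCycle → ∀ {S} → Nonempty S →
               ∃ λ v → v ∈ S × (Isolated S v ⊎ Dominating S v)
  eliminable noAlt {S} S-nonempty
    with greatest (NeighbourhoodBelow S) S (λ {u} {z} _ _ → neighbourhoods-nested noAlt S u z)
                  below-transitive S-nonempty
  ... | v , v∈S , below-v with dominating-or-witness S v
  ... | inj₁ v-dominating = v , v∈S , inj₂ v-dominating
  ... | inj₂ (u , u∈S , u≢v , v≁u) = u , u∈S , inj₁ u-isolated
    where
    u-isolated : Isolated S u
    u-isolated z z∈S z≢u with u ~? z
    ... | no ¬u~z = ¬-not ¬u~z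
    ... | yes u~z with z ≟ v
    ...   | yes refl = ⊥-elim (~⇒¬≁ (~-sym u~z) v≁u)
    ...   | no z≢v   = ⊥-elim (~⇒¬≁ (below-v z∈S u u∈S (z≢u ∘ sym) u≢v (~-sym u~z)) v≁u)

  elimination-induction : NoAlternatingCycle → (P : Subset n → Set) →
                          (∀ {S} → Empty S → P S) →
                          (∀ {S v} → v ∈ S → Isolated S v ⊎ Dominating S v → P (S - v) → P S) →
                          ∀ S → P S
  elimination-induction noAlt P base step = removal-induction P λ S IH → by-cases S IH
    where
    by-cases : ∀ S → (∀ {x} → x ∈ S → P (S - x)) → P S
    by-cases S IH with nonempty? S
    ... | no S-empty       = base S-empty
    ... | yes S-nonempty with eliminable noAlt S-nonempty
    ... | v , v∈S , v-kind = step v∈S v-kind (IH v∈S)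

  -- No alternating 4-cycle ⇒ (1).

  independent-⊆ : ∀ {X Y} → Y ⊆ X → IsIndependentG G X → IsIndependentG G Y
  independent-⊆ Y⊆X X-ind i j i∈Y j∈Y = X-ind i j (Y⊆X i∈Y) (Y⊆X j∈Y)

  independent-⊆⁅⁆ : ∀ {X v} → X ⊆ ⁅ v ⁆ → IsIndependentG G X
  independent-⊆⁅⁆ {v = v} X⊆v i j i∈X j∈X
    rewrite x∈⁅y⁆⇒x≡y v (X⊆v i∈X) | x∈⁅y⁆⇒x≡y v (X⊆v j∈X) = irref G v

  independent-add-isolated : ∀ {S X v} → X ⊆ S → Isolated S v →
                             IsIndependentG G (X - v) → IsIndependentG G X
  independent-add-isolated {v = v} X⊆S v-iso X-v-ind i j i∈X j∈X
    with ∈-or-removed v i∈X | ∈-or-removed v j∈X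
  ... | inj₁ refl   | inj₁ refl   = irref G i
  ... | inj₁ refl   | inj₂ j∈X-v = v-iso j (X⊆S j∈X) (proj₂ (∈-remove⁻ j∈X-v))
  ... | inj₂ i∈X-v | inj₁ refl   = ≁-sym (v-iso i (X⊆S i∈X) (proj₂ (∈-remove⁻ i∈X-v)))
  ... | inj₂ i∈X-v | inj₂ j∈X-v = X-v-ind i j i∈X-v j∈X-v

  -- Threshold weights for the induced subgraph G[S].  Positivity is an
  -- invariant so that a dominating vertex can receive the whole bound.
  record ThresholdOn (S : Subset n) : Set where
    field
      weight     : Fin n → ℕ
      bound      : ℕ
      bound-pos  : 1 ≤ bound
      weight-pos : ∀ {i} → i ∈ S → 1 ≤ weight i
      separates  : ∀ {X} → X ⊆ S → (wsum weight X ≤ bound ⇔ IsIndependentG G X)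

  threshold-empty : ∀ {S} → Empty S → ThresholdOn S
  threshold-empty {S} S-empty = record
    { weight     = const 1
    ; bound      = 1
    ; bound-pos  = ≤-refl
    ; weight-pos = λ i∈S → contradiction (_ , i∈S) S-empty
    ; separates  = λ X⊆S → mk⇔
        (λ _ i _ i∈X _ → contradiction (i , X⊆S i∈X) S-empty)
        (λ _ → ≤-trans (≤-reflexive (wsum-empty (const 1) λ (i , i∈X) → S-empty (i , X⊆S i∈X))) z≤n)
    }

  -- An isolated vertex gets weight 1 and all other weights double: the
  -- parity bit of v cannot push an independent set over 2t + 1.
  threshold-isolated : ∀ {S v} → v ∈ S → Isolated S v → ThresholdOn (S - v) → ThresholdOn S
  threshold-isolated {S} {v} v∈S v-iso T = record
    { weight     = weight′
    ; bound      = suc (t + t)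
    ; bound-pos  = s≤s z≤n
    ; weight-pos = positive
    ; separates  = separates′
    }
    where
    open ThresholdOn T renaming (weight to w; bound to t)
    weight′ : Fin n → ℕ
    weight′ = updateAt (λ i → w i + w i) v (const 1)

    split : ∀ X → wsum weight′ X ≡ ind (lookup X v) + (wsum w (X - v) + wsum w (X - v))
    split X = trans (wsum-update _ 1 X v) (cong (ind (lookup X v) +_) (wsum-+ w w (X - v)))

    positive : ∀ {i} → i ∈ S → 1 ≤ weight′ i
    positive {i} i∈S with ∈-or-removed v i∈S
    ... | inj₁ refl    = ≤-reflexive (sym (updateAt-updates v (λ i → w i + w i)))
    ... | inj₂ i∈S-v = subst (1 ≤_) (sym (updateAt-minimal i v _ (proj₂ (∈-remove⁻ i∈S-v))))
                               (≤-trans (weight-pos i∈S-v) (m≤m+n _ _))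

    separates′ : ∀ {X} → X ⊆ S → (wsum weight′ X ≤ suc (t + t) ⇔ IsIndependentG G X)
    separates′ {X} X⊆S = mk⇔
      (λ le → independent-add-isolated X⊆S v-iso (Equivalence.to X-v-separated
                (half-bound (≤-trans (m≤n+m _ (ind (lookup X v)))
                                     (subst (_≤ suc (t + t)) (split X) le)))))
      (λ X-ind → let s≤t = Equivalence.from X-v-separated (independent-⊆ (p─q⊆p X ⁅ v ⁆) X-ind)
                 in subst (_≤ suc (t + t)) (sym (split X))
                          (+-mono-≤ (ind≤1 (lookup X v)) (+-mono-≤ s≤t s≤t)))
      where
      X-v-separated = separates (remove-mono {v = v} X⊆S)

  -- A dominating vertex gets the whole bound as weight: a set containing
  -- it is independent exactly when nothing else is in it.
  threshold-dominating : ∀ {S v} → v ∈ S → Dominating S v → ThresholdOn (S - v) → ThresholdOn S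
  threshold-dominating {S} {v} v∈S v-dom T = record
    { weight     = weight′
    ; bound      = t
    ; bound-pos  = bound-pos
    ; weight-pos = positive
    ; separates  = separates′
    }
    where
    open ThresholdOn T renaming (weight to w; bound to t)
    weight′ : Fin n → ℕ
    weight′ = updateAt w v (const t)

    positive : ∀ {i} → i ∈ S → 1 ≤ weight′ i
    positive {i} i∈S with ∈-or-removed v i∈S
    ... | inj₁ refl    = subst (1 ≤_) (sym (updateAt-updates v w)) bound-pos
    ... | inj₂ i∈S-v = subst (1 ≤_) (sym (updateAt-minimal i v w (proj₂ (∈-remove⁻ i∈S-v))))
                               (weight-pos i∈S-v)

    separates′ : ∀ {X} → X ⊆ S → (wsum weight′ X ≤ t ⇔ IsIndependentG G X)
    separates′ {X} X⊆S with v ∈? X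
    ... | no v∉X = mk⇔
      (λ le → independent-⊆ (⊆-remove v∉X) (Equivalence.to X-v-separated (subst (_≤ t) weight-X le)))
      (λ X-ind → subst (_≤ t) (sym weight-X)
                   (Equivalence.from X-v-separated (independent-⊆ (p─q⊆p X ⁅ v ⁆) X-ind)))
      where
      X-v-separated = separates (remove-mono {v = v} X⊆S)
      weight-X : wsum weight′ X ≡ wsum w (X - v)
      weight-X = wsum-update-∉ w t v∉X
    ... | yes v∈X with nonempty? (X - v)
    ...   | yes (u , u∈X-v) = mk⇔ (⊥-elim ∘ too-heavy) (λ X-ind → ⊥-elim (~⇒¬≁ v~u (X-ind v u v∈X u∈X)))
      where
      u∈X = proj₁ (∈-remove⁻ u∈X-v)
      v~u = v-dom u (X⊆S u∈X) (proj₂ (∈-remove⁻ u∈X-v))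
      too-heavy : wsum weight′ X ≤ t → ⊥
      too-heavy le = n≮n t (begin-strict
        t                  <⟨ m<m+n t (≤-trans (weight-pos (remove-mono X⊆S u∈X-v)) (∈⇒≤wsum w u∈X-v)) ⟩
        t + wsum w (X - v) ≡⟨ wsum-update-∈ w t v∈X ⟨
        wsum weight′ X     ≤⟨ le ⟩
        t                  ∎)
        where open ≤-Reasoning
    ...   | no X-v-empty = mk⇔
      (λ _ → independent-⊆⁅⁆ (removed-empty X-v-empty))
      (λ _ → ≤-reflexive (begin
        wsum weight′ X     ≡⟨ wsum-update-∈ w t v∈X ⟩
        t + wsum w (X - v) ≡⟨ cong (t +_) (wsum-empty w X-v-empty) ⟩
        t + 0              ≡⟨ +-identityʳ t ⟩
        t                  ∎))
      where open ≡-Reasoning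

  noAlternatingCycle⇒threshold : NoAlternatingCycle → IsThresholdGraph G
  noAlternatingCycle⇒threshold noAlt = weight , bound , λ X → separates (λ _ → ∈⊤)
    where
    step : ∀ {S v} → v ∈ S → Isolated S v ⊎ Dominating S v → ThresholdOn (S - v) → ThresholdOn S
    step v∈S (inj₁ v-isolated)   = threshold-isolated v∈S v-isolated
    step v∈S (inj₂ v-dominating) = threshold-dominating v∈S v-dominating
    open ThresholdOn (elimination-induction noAlt ThresholdOn threshold-empty step full)

  -- Maximal cliques of G[S] under removal of an isolated or a dominating
  -- vertex v.

  clique-⊆ : ∀ {K Y} → Y ⊆ K → IsClique G K → IsClique G Y
  clique-⊆ Y⊆K K-clique i j i∈Y j∈Y = K-clique i j (Y⊆K i∈Y) (Y⊆K j∈Y)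

  maximal-nonempty : ∀ {S K} → MaximalCliqueIn S K → Nonempty S → Nonempty K
  maximal-nonempty {K = K} K-max S-nonempty with nonempty? K
  ... | yes K-nonempty = K-nonempty
  ... | no K-empty     = contradiction S-nonempty (empty-maximal K-max K-empty)

  isolated-maximal : ∀ {S v} → v ∈ S → Isolated S v → MaximalCliqueIn S ⁅ v ⁆
  isolated-maximal {S} {v} v∈S v-iso = record
    { within  = λ x∈⁅v⁆ → subst (_∈ S) (sym (x∈⁅y⁆⇒x≡y v x∈⁅v⁆)) v∈S
    ; clique  = singleton-clique v
    ; maximal = only-v
    }
    where
    only-v : ∀ {Y} → Y ⊆ S → IsClique G Y → ⁅ v ⁆ ⊆ Y → Y ⊆ ⁅ v ⁆
    only-v Y⊆S Y-clique v∈Y {y} y∈Y with y ≟ v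
    ... | yes refl = x∈⁅x⁆ v
    ... | no y≢v   = ⊥-elim (~⇒¬≁ (Y-clique v y (v∈Y (x∈⁅x⁆ v)) y∈Y (y≢v ∘ sym)) (v-iso y (Y⊆S y∈Y) y≢v))

  isolated-lift : ∀ {S K v} → Isolated S v → Nonempty (S - v) →
                  MaximalCliqueIn (S - v) K → MaximalCliqueIn S K
  isolated-lift {S} {K} {v} v-iso S-v-nonempty K-max = record
    { within  = p─q⊆p S ⁅ v ⁆ ∘ within K-max
    ; clique  = clique K-max
    ; maximal = λ Y⊆S Y-clique K⊆Y → maximal K-max (Y⊆S-v Y⊆S Y-clique K⊆Y) Y-clique K⊆Y
    }
    where
    Y⊆S-v : ∀ {Y} → Y ⊆ S → IsClique G Y → K ⊆ Y → Y ⊆ S - v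
    Y⊆S-v {Y} Y⊆S Y-clique K⊆Y {y} y∈Y with y ≟ v | maximal-nonempty K-max S-v-nonempty
    ... | no y≢v   | _ = x∈p∧x≢y⇒x∈p-y (Y⊆S y∈Y) y≢v
    ... | yes refl | k , k∈K =
      let k∈S , k≢v = ∈-remove⁻ (within K-max k∈K)
      in ⊥-elim (~⇒¬≁ (Y-clique v k y∈Y (K⊆Y k∈K) (k≢v ∘ sym)) (v-iso k k∈S k≢v))

  dominating-in-maximal : ∀ {S K v} → v ∈ S → Dominating S v → MaximalCliqueIn S K → v ∈ K
  dominating-in-maximal v∈S v-dom K-max = absorb K-max v∈S λ u u∈K → v-dom u (within K-max u∈K)

  dominating-lower : ∀ {S K v} → v ∈ S → Dominating S v →
                     MaximalCliqueIn S K → MaximalCliqueIn (S - v) (K - v)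
  dominating-lower {S} {K} {v} v∈S v-dom K-max = record
    { within  = remove-mono (within K-max)
    ; clique  = clique-⊆ (p─q⊆p K ⁅ v ⁆) (clique K-max)
    ; maximal = lower-maximal
    }
    where
    lower-maximal : ∀ {Y} → Y ⊆ S - v → IsClique G Y → K - v ⊆ Y → Y ⊆ K - v
    lower-maximal {Y} Y⊆S-v Y-clique K-v⊆Y y∈Y =
      x∈p∧x≢y⇒x∈p-y (Y∪v⊆K (p⊆p∪q ⁅ v ⁆ y∈Y)) (proj₂ (∈-remove⁻ (Y⊆S-v y∈Y)))
      where
      Y∪v⊆S : Y ∪ ⁅ v ⁆ ⊆ S
      Y∪v⊆S x∈ with ∈-insert⁻ x∈
      ... | inj₁ x∈Y  = proj₁ (∈-remove⁻ (Y⊆S-v x∈Y))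
      ... | inj₂ refl = v∈S
      K⊆Y∪v : K ⊆ Y ∪ ⁅ v ⁆
      K⊆Y∪v k∈K with ∈-or-removed v k∈K
      ... | inj₁ refl    = ∈-insert v
      ... | inj₂ k∈K-v = p⊆p∪q ⁅ v ⁆ (K-v⊆Y k∈K-v)
      Y∪v⊆K : Y ∪ ⁅ v ⁆ ⊆ K
      Y∪v⊆K = maximal K-max Y∪v⊆S
        (clique-insert Y-clique λ u u∈Y → v-dom u (proj₁ (∈-remove⁻ (Y⊆S-v u∈Y)))) K⊆Y∪v

  dominating-raise : ∀ {S K v} → v ∈ S → Dominating S v →
                     MaximalCliqueIn (S - v) K → MaximalCliqueIn S (K ∪ ⁅ v ⁆)
  dominating-raise {S} {K} {v} v∈S v-dom K-max = record
    { within  = K∪v⊆S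
    ; clique  = clique-insert (clique K-max) λ u u∈K → v-dom u (K⊆S u∈K)
    ; maximal = raise-maximal
    }
    where
    K⊆S : K ⊆ S
    K⊆S = p─q⊆p S ⁅ v ⁆ ∘ within K-max
    K∪v⊆S : K ∪ ⁅ v ⁆ ⊆ S
    K∪v⊆S x∈ with ∈-insert⁻ x∈
    ... | inj₁ x∈K  = K⊆S x∈K
    ... | inj₂ refl = v∈S
    raise-maximal : ∀ {Y} → Y ⊆ S → IsClique G Y → K ∪ ⁅ v ⁆ ⊆ Y → Y ⊆ K ∪ ⁅ v ⁆
    raise-maximal {Y} Y⊆S Y-clique K∪v⊆Y y∈Y with ∈-or-removed v y∈Y
    ... | inj₁ refl    = ∈-insert v
    ... | inj₂ y∈Y-v = p⊆p∪q ⁅ v ⁆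
      (maximal K-max (remove-mono Y⊆S) (clique-⊆ (p─q⊆p Y ⁅ v ⁆) Y-clique)
        (λ k∈K → x∈p∧x≢y⇒x∈p-y (K∪v⊆Y (p⊆p∪q ⁅ v ⁆ k∈K)) (proj₂ (∈-remove⁻ (within K-max k∈K))))
        y∈Y-v)

  -- No alternating 4-cycle ⇒ (3).

  ContainsMaximalClique : Subset n → Subset n → Set
  ContainsMaximalClique S X = ∃ λ K → MaximalCliqueIn S K × K ⊆ X

  record CliqueThresholdOn (S : Subset n) : Set where
    field
      weight    : Fin n → ℕ
      bound     : ℕ
      separates : ∀ {X} → X ⊆ S → (bound ≤ wsum weight X ⇔ ContainsMaximalClique S X)

  clique-threshold-empty : ∀ {S} → Empty S → CliqueThresholdOn S
  clique-threshold-empty {S} S-empty = record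
    { weight    = const 0
    ; bound     = 0
    ; separates = λ {X} _ → mk⇔ (λ _ → ∅-contained X) (λ _ → z≤n)
    }
    where
    ∅⊆ : ∀ X → ∅ ⊆ X
    ∅⊆ _ x∈∅ = contradiction x∈∅ ∉⊥
    ∅-maximal : MaximalCliqueIn S ∅
    ∅-maximal = record
      { within  = ∅⊆ S
      ; clique  = λ i _ i∈∅ → contradiction i∈∅ ∉⊥
      ; maximal = λ Y⊆S _ _ y∈Y → contradiction (_ , Y⊆S y∈Y) S-empty
      }
    ∅-contained : ∀ X → ContainsMaximalClique S X
    ∅-contained X = ∅ , ∅-maximal , ∅⊆ X

  clique-threshold-singleton : ∀ {S v} → v ∈ S → Isolated S v → Empty (S - v) → CliqueThresholdOn S
  clique-threshold-singleton {S} {v} v∈S v-iso S-v-empty = record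
    { weight    = const 1
    ; bound     = 1
    ; separates = λ X⊆S → mk⇔ (contains-v X⊆S) heavy
    }
    where
    contains-v : ∀ {X} → X ⊆ S → 1 ≤ wsum (const 1) X → ContainsMaximalClique S X
    contains-v {X} X⊆S 1≤wX with positive⇒nonempty (const 1) 1≤wX
    ... | x , x∈X = ⁅ v ⁆ , isolated-maximal v∈S v-iso , ⁅⁆⊆ (subst (_∈ X) x≡v x∈X)
      where
      x≡v : x ≡ v
      x≡v = x∈⁅y⁆⇒x≡y v (removed-empty S-v-empty (X⊆S x∈X))
    heavy : ∀ {X} → ContainsMaximalClique S X → 1 ≤ wsum (const 1) X
    heavy (K , K-max , K⊆X) with maximal-nonempty K-max (v , v∈S)
    ... | k , k∈K = ∈⇒≤wsum (const 1) (K⊆X k∈K)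

  -- An isolated vertex takes the whole bound: it is a maximal clique
  -- by itself, and the other maximal cliques are those of G[S - v].
  clique-threshold-isolated : ∀ {S v} → v ∈ S → Isolated S v → Nonempty (S - v) →
                              CliqueThresholdOn (S - v) → CliqueThresholdOn S
  clique-threshold-isolated {S} {v} v∈S v-iso S-v-nonempty T = record
    { weight    = weight′
    ; bound     = t
    ; separates = separates′
    }
    where
    open CliqueThresholdOn T renaming (weight to w; bound to t)
    weight′ : Fin n → ℕ
    weight′ = updateAt w v (const t)

    separates′ : ∀ {X} → X ⊆ S → (t ≤ wsum weight′ X ⇔ ContainsMaximalClique S X)
    separates′ {X} X⊆S with v ∈? X
    ... | yes v∈X = mk⇔ (λ _ → contains-v)
      (λ _ → subst (t ≤_) (sym (wsum-update-∈ w t v∈X)) (m≤m+n t _))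
      where
      contains-v : ContainsMaximalClique S X
      contains-v = ⁅ v ⁆ , isolated-maximal v∈S v-iso , ⁅⁆⊆ v∈X
    ... | no v∉X = mk⇔
      (λ t≤ → from-smaller (Equivalence.to X-v-separated (subst (t ≤_) (wsum-update-∉ w t v∉X) t≤)))
      (λ contains → subst (t ≤_) (sym (wsum-update-∉ w t v∉X))
                           (Equivalence.from X-v-separated (to-smaller contains)))
      where
      X-v-separated = separates (remove-mono {v = v} X⊆S)
      from-smaller : ContainsMaximalClique (S - v) (X - v) → ContainsMaximalClique S X
      from-smaller (K , K-max , K⊆X-v) =
        K , isolated-lift v-iso S-v-nonempty K-max , p─q⊆p X ⁅ v ⁆ ∘ K⊆X-v
      to-smaller : ContainsMaximalClique S X → ContainsMaximalClique (S - v) (X - v)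
      to-smaller (K , K-max , K⊆X) =
        K , restrict K-max (p─q⊆p S ⁅ v ⁆) (K⊆S-v) , ⊆-remove v∉X ∘ K⊆X
        where
        K⊆S-v : K ⊆ S - v
        K⊆S-v k∈K = x∈p∧x≢y⇒x∈p-y (within K-max k∈K) λ { refl → v∉X (K⊆X k∈K) }

  -- A dominating vertex weighs more than all of S - v together, so a
  -- set is heavy only if it contains v; it lies in every maximal clique.
  clique-threshold-dominating : ∀ {S v} → v ∈ S → Dominating S v →
                                CliqueThresholdOn (S - v) → CliqueThresholdOn S
  clique-threshold-dominating {S} {v} v∈S v-dom T = record
    { weight    = weight′
    ; bound     = t + M
    ; separates = separates′
    }
    where
    open CliqueThresholdOn T renaming (weight to w; bound to t)
    M : ℕ
    M = suc (wsum w (S - v))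
    weight′ : Fin n → ℕ
    weight′ = updateAt w v (const M)

    separates′ : ∀ {X} → X ⊆ S → (t + M ≤ wsum weight′ X ⇔ ContainsMaximalClique S X)
    separates′ {X} X⊆S with v ∈? X
    ... | yes v∈X = mk⇔
      (λ le → from-smaller (Equivalence.to X-v-separated
                 (+-cancelˡ-≤ M t _ (subst₂ _≤_ (+-comm t M) (wsum-update-∈ w M v∈X) le))))
      (λ contains → subst₂ _≤_ (+-comm M t) (sym (wsum-update-∈ w M v∈X))
                      (+-monoʳ-≤ M (Equivalence.from X-v-separated (to-smaller contains))))
      where
      X-v-separated = separates (remove-mono {v = v} X⊆S)
      from-smaller : ContainsMaximalClique (S - v) (X - v) → ContainsMaximalClique S X
      from-smaller (K , K-max , K⊆X-v) = K ∪ ⁅ v ⁆ , dominating-raise v∈S v-dom K-max , K∪v⊆X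
        where
        K∪v⊆X : K ∪ ⁅ v ⁆ ⊆ X
        K∪v⊆X x∈ with ∈-insert⁻ x∈
        ... | inj₁ x∈K  = p─q⊆p X ⁅ v ⁆ (K⊆X-v x∈K)
        ... | inj₂ refl = v∈X
      to-smaller : ContainsMaximalClique S X → ContainsMaximalClique (S - v) (X - v)
      to-smaller (K , K-max , K⊆X) = K - v , dominating-lower v∈S v-dom K-max , remove-mono K⊆X
    ... | no v∉X = mk⇔ (⊥-elim ∘ too-light)
      (λ (K , K-max , K⊆X) → ⊥-elim (v∉X (K⊆X (dominating-in-maximal v∈S v-dom K-max))))
      where
      too-light : t + M ≤ wsum weight′ X → ⊥
      too-light le = n≮n (wsum w (S - v)) (begin-strict
        wsum w (S - v) <⟨ n<1+n _ ⟩
        M              ≤⟨ m≤n+m M t ⟩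
        t + M          ≤⟨ le ⟩
        wsum weight′ X ≡⟨ wsum-update-∉ w M v∉X ⟩
        wsum w (X - v) ≤⟨ wsum-mono w (remove-mono {v = v} X⊆S) ⟩
        wsum w (S - v) ∎)
        where open ≤-Reasoning

  noAlternatingCycle⇒clique-threshold : NoAlternatingCycle → IsThresholdHypergraph (cliqueHypergraph G)
  noAlternatingCycle⇒clique-threshold noAlt = weight , bound , λ X → mk⇔
    (to-dependent ∘ Equivalence.to (separates (λ _ → ∈⊤)))
    (Equivalence.from (separates (λ _ → ∈⊤)) ∘ from-dependent)
    where
    to-dependent : ∀ {X} → ContainsMaximalClique full X → Dependent (cliqueHypergraph G) X
    to-dependent (K , K-max , K⊆X) = K , full⇒global K-max , K⊆X
    from-dependent : ∀ {X} → Dependent (cliqueHypergraph G) X → ContainsMaximalClique full X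
    from-dependent (K , K-max , K⊆X) = K , global⇒full K-max , K⊆X
    step : ∀ {S v} → v ∈ S → Isolated S v ⊎ Dominating S v →
           CliqueThresholdOn (S - v) → CliqueThresholdOn S
    step {S} {v} v∈S (inj₁ v-isolated) T with nonempty? (S - v)
    ... | yes S-v-nonempty = clique-threshold-isolated v∈S v-isolated S-v-nonempty T
    ... | no S-v-empty     = clique-threshold-singleton v∈S v-isolated S-v-empty
    step v∈S (inj₂ v-dominating) T = clique-threshold-dominating v∈S v-dominating T
    open CliqueThresholdOn
      (elimination-induction noAlt CliqueThresholdOn clique-threshold-empty step full)

  -- (2) ⇔ no alternating 4-cycle.

  record CrossingCliques (a b c d : Fin n) : Set where
    field
      e f   : Subset n
      e-max : IsMaximalClique G e
      f-max : IsMaximalClique G f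
      a∈e   : a ∈ e
      b∈e   : b ∈ e
      c∈f   : c ∈ f
      d∈f   : d ∈ f
      a∉f   : a ∉ f
      b∉f   : b ∉ f
      c∉e   : c ∉ e
      d∉e   : d ∉ e

  crossing-cliques : ∀ {a b c d} → a ~ b → c ~ d → a ≁ c → b ≁ d → a ≢ c → b ≢ d →
                     CrossingCliques a b c d
  crossing-cliques {a} {b} {c} {d} a~b c~d a≁c b≁d a≢c b≢d
    with extend (edge-clique a~b) | extend (edge-clique c~d)
  ... | e , e-max , ab⊆e | f , f-max , cd⊆f = record
    { e     = e
    ; f     = f
    ; e-max = e-max
    ; f-max = f-max
    ; a∈e   = a∈e
    ; b∈e   = b∈e
    ; c∈f   = c∈f
    ; d∈f   = d∈f
    ; a∉f   = clique-excludes (proj₁ f-max) c∈f a≢c a≁c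
    ; b∉f   = clique-excludes (proj₁ f-max) d∈f b≢d b≁d
    ; c∉e   = clique-excludes (proj₁ e-max) a∈e (a≢c ∘ sym) (≁-sym a≁c)
    ; d∉e   = clique-excludes (proj₁ e-max) b∈e (b≢d ∘ sym) (≁-sym b≁d)
    }
    where
    a∈e = ab⊆e (p⊆p∪q ⁅ b ⁆ (x∈⁅x⁆ a))
    b∈e = ab⊆e (∈-insert b)
    c∈f = cd⊆f (p⊆p∪q ⁅ d ⁆ (x∈⁅x⁆ c))
    d∈f = cd⊆f (∈-insert d)

  -- Both e ∖ f and f ∖ e have two elements, so C(G) is not 1-Sperner.
  sperner⇒noAlternatingCycle : Is1Sperner (cliqueHypergraph G) → NoAlternatingCycle
  sperner⇒noAlternatingCycle sperner a~b c~d a≁c b≁d a≢c b≢d = 2≰1 (begin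
    2                   ≤⟨ ⊓-glb (two⇒2≤∣∣ (x∈p∧x∉q⇒x∈p─q a∈e a∉f) (x∈p∧x∉q⇒x∈p─q b∈e b∉f) (~⇒≢ a~b))
                                 (two⇒2≤∣∣ (x∈p∧x∉q⇒x∈p─q c∈f c∉e) (x∈p∧x∉q⇒x∈p─q d∈f d∉e) (~⇒≢ c~d)) ⟩
    ∣ e ─ f ∣ ⊓ ∣ f ─ e ∣ ≡⟨ sperner e f e-max f-max (λ e≡f → a∉f (subst (_ ∈_) e≡f a∈e)) ⟩
    1                   ∎)
    where
    open CrossingCliques (crossing-cliques a~b c~d a≁c b≁d a≢c b≢d)
    open ≤-Reasoning
    2≰1 : ¬ 2 ≤ 1
    2≰1 (s≤s ())

  member-adjacent : ∀ {K x y} → IsMaximalClique G K → x ∈ K → y ∈ K → x ≢ y → x ~ y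
  member-adjacent K-max = proj₁ K-max _ _

  no-two-private-pairs : NoAlternatingCycle → ∀ {E F a b c d} →
                         IsMaximalClique G E → IsMaximalClique G F →
                         a ∈ E → b ∈ E → a ∉ F → b ∉ F → a ≢ b →
                         c ∈ F → d ∈ F → c ∉ E → d ∉ E → c ≢ d → ⊥
  no-two-private-pairs noAlt {E} {F} {a} {b} {c} {d} E-max F-max a∈E b∈E a∉F b∉F a≢b c∈F d∈F c∉E d∉E c≢d
    with non-neighbour (global⇒full F-max) ∈⊤ a∉F | non-neighbour (global⇒full F-max) ∈⊤ b∉F
  ... | c₁ , c₁∈F , c₁≢a , a≁c₁ | c₂ , c₂∈F , c₂≢b , b≁c₂ with c₁ ≟ c₂
  ... | no c₁≢c₂ = noAlt (member-adjacent E-max a∈E b∈E a≢b) (member-adjacent F-max c₁∈F c₂∈F c₁≢c₂)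
                         a≁c₁ b≁c₂ (c₁≢a ∘ sym) (c₂≢b ∘ sym)
  ... | yes refl with avoid {P = λ z → z ∈ F × z ∉ E} (c∈F , c∉E) (d∈F , d∉E) c≢d c₁
  ... | z , (z∈F , z∉E) , z≢c₁ with non-neighbour (global⇒full E-max) ∈⊤ z∉E
  ... | a′ , a′∈E , a′≢z , z≁a′ with a′ ≟ a
  ... | no a′≢a  = noAlt (member-adjacent E-max a∈E a′∈E (a′≢a ∘ sym))
                         (member-adjacent F-max c₁∈F z∈F (z≢c₁ ∘ sym))
                         a≁c₁ (≁-sym z≁a′) (c₁≢a ∘ sym) a′≢z
  ... | yes refl = noAlt (member-adjacent E-max b∈E a∈E (a≢b ∘ sym))
                         (member-adjacent F-max c₁∈F z∈F (z≢c₁ ∘ sym))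
                         b≁c₂ (≁-sym z≁a′) (c₂≢b ∘ sym) a′≢z

  outside-vertex : ∀ {E F} → IsMaximalClique G E → IsMaximalClique G F → E ≢ F →
                   ∃ λ x → x ∈ E × x ∉ F
  outside-vertex {E} {F} E-max F-max E≢F with ⊆-or-outside E F
  ... | inj₁ E⊆F    = contradiction (⊆-antisym E⊆F (proj₂ E-max F (proj₁ F-max) E⊆F)) E≢F
  ... | inj₂ outside = outside

  -- Each of e ∖ f, f ∖ e is nonempty, and one of them has a single element.
  noAlternatingCycle⇒sperner : NoAlternatingCycle → Is1Sperner (cliqueHypergraph G)
  noAlternatingCycle⇒sperner noAlt e f e-max f-max e≢f
    with outside-vertex e-max f-max e≢f | outside-vertex f-max e-max (e≢f ∘ sym)
  ... | x , x∈e , x∉f | y , y∈f , y∉e =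
    min-is-one (∈⇒1≤∣∣ x∈e─f) (∈⇒1≤∣∣ y∈f─e)
      (one-side-small (at-most-one-or-two x∈e─f) (at-most-one-or-two y∈f─e))
    where
    x∈e─f = x∈p∧x∉q⇒x∈p─q x∈e x∉f
    y∈f─e = x∈p∧x∉q⇒x∈p─q y∈f y∉e
    one-side-small : ∣ e ─ f ∣ ≤ 1 ⊎ ∃ (λ x′ → x′ ∈ e ─ f × x′ ≢ x) →
                     ∣ f ─ e ∣ ≤ 1 ⊎ ∃ (λ y′ → y′ ∈ f ─ e × y′ ≢ y) →
                     ∣ e ─ f ∣ ≤ 1 ⊎ ∣ f ─ e ∣ ≤ 1
    one-side-small (inj₁ small) _            = inj₁ small
    one-side-small _            (inj₁ small) = inj₂ small
    one-side-small (inj₂ (x′ , x′∈e─f , x′≢x)) (inj₂ (y′ , y′∈f─e , y′≢y)) = ⊥-elim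
      (no-two-private-pairs noAlt e-max f-max
        x∈e (p─q⊆p e f x′∈e─f) x∉f (x∈p─q⇒x∉q x′∈e─f) (x′≢x ∘ sym)
        y∈f (p─q⊆p f e y′∈f─e) y∉e (x∈p─q⇒x∉q y′∈f─e) (y′≢y ∘ sym))

  -- (4) ⇒ no alternating 4-cycle.

  N : Fin n → Subset n
  N v = tabulate (adj G v)

  ∈N⁻ : ∀ {u v} → u ∈ N v → v ~ u
  ∈N⁻ = ∈-tabulate⁻

  ∈∁N⁻ : ∀ {u v} → u ∈ ∁ (N v) → v ≁ u
  ∈∁N⁻ u∈∁N = ¬-not (x∈∁p⇒x∉p u∈∁N ∘ ∈-tabulate⁺)

  exchange-contradiction : Is2Asummable (cliqueHypergraph G) →
                           ∀ {e f} → IsMaximalClique G e → IsMaximalClique G f →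
                           ∀ U I D → (∀ i → χ U i + χ I i ≡ χ e i + χ f i) →
                           D ⊆ U → (∀ {i} → i ∈ D → i ∉ I) →
                           Independent (cliqueHypergraph G) (U ─ D) →
                           Independent (cliqueHypergraph G) (I ∪ D) → ⊥
  exchange-contradiction asummable {e} {f} e-max f-max U I D same D⊆U D∩I=∅ A₁-ind A₂-ind =
    asummable (U ─ D) (I ∪ D) e f A₁-ind A₂-ind (e , e-max , ⊆-refl) (f , f-max , ⊆-refl)
      λ i → trans (χ-exchange U I D D⊆U D∩I=∅ i) (same i)

  maximal-⊆ : ∀ {g K} → IsMaximalClique G g → IsClique G K → g ⊆ K → K ⊆ g
  maximal-⊆ {K = K} g-max K-clique = proj₂ g-max K K-clique

  -- Case 1: b₀ ∈ e ∖ f has a neighbour y₀ ∈ f ∖ e, and x′ ≠ b₀ is another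
  -- vertex of e ∖ f.  Move b₀ between
  --   U = e ∪ (f ∩ N b₀)   and   I = f ∩ (e ∪ ∁ N b₀).
  -- Every maximal clique inside U - b₀ would absorb b₀; one inside I ∪ {b₀}
  -- would be e (missing x′) or f (missing y₀).
  adjacent-private : Is2Asummable (cliqueHypergraph G) →
                     ∀ {e f b₀ y₀ x′} → IsMaximalClique G e → IsMaximalClique G f →
                     b₀ ∈ e → b₀ ∉ f → y₀ ∈ f → y₀ ∉ e → b₀ ~ y₀ →
                     x′ ∈ e → x′ ∉ f → x′ ≢ b₀ → ⊥
  adjacent-private asummable {e} {f} {b₀} {y₀} {x′} e-max f-max
    b₀∈e b₀∉f y₀∈f y₀∉e b₀~y₀ x′∈e x′∉f x′≢b₀ =
    exchange-contradiction asummable e-max f-max U I ⁅ b₀ ⁆ (χ-split e f (N b₀))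
      (⁅⁆⊆ (p⊆p∪q (f ∩ N b₀) b₀∈e))
      (λ i∈⁅b₀⁆ i∈I → b₀∉f (subst (_∈ f) (x∈⁅y⁆⇒x≡y b₀ i∈⁅b₀⁆) (proj₁ (x∈p∩q⁻ f _ i∈I))))
      A₁-ind A₂-ind
    where
    U I : Subset n
    U = e ∪ (f ∩ N b₀)
    I = f ∩ (e ∪ ∁ (N b₀))

    A₁-ind : Independent (cliqueHypergraph G) (U ─ ⁅ b₀ ⁆)
    A₁-ind (g , g-max , g⊆A₁) = x∈p─q⇒x∉q (g⊆A₁ (absorb (global⇒full g-max) ∈⊤ b₀-dominates)) (x∈⁅x⁆ b₀)
      where
      b₀-dominates : Dominating g b₀
      b₀-dominates u u∈g u≢b₀ with x∈p∪q⁻ e (f ∩ N b₀) (p─q⊆p U ⁅ b₀ ⁆ (g⊆A₁ u∈g))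
      ... | inj₁ u∈e   = member-adjacent e-max b₀∈e u∈e (u≢b₀ ∘ sym)
      ... | inj₂ u∈f∩N = ∈N⁻ (proj₂ (x∈p∩q⁻ f (N b₀) u∈f∩N))

    A₂-ind : Independent (cliqueHypergraph G) (I ∪ ⁅ b₀ ⁆)
    A₂-ind (g , g-max , g⊆A₂) with b₀ ∈? g
    ... | yes b₀∈g = x′∉A₂ (g⊆A₂ (maximal-⊆ g-max (proj₁ e-max) g⊆e x′∈e))
      where
      g⊆e : g ⊆ e
      g⊆e u∈g with ∈-insert⁻ (g⊆A₂ u∈g)
      ... | inj₂ refl = b₀∈e
      ... | inj₁ u∈I with x∈p∪q⁻ e (∁ (N b₀)) (proj₂ (x∈p∩q⁻ f _ u∈I))
      ...   | inj₁ u∈e  = u∈e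
      ...   | inj₂ u∈∁N = ⊥-elim (~⇒¬≁ (member-adjacent g-max b₀∈g u∈g b₀≢u) (∈∁N⁻ u∈∁N))
        where
        b₀≢u : b₀ ≢ _
        b₀≢u refl = b₀∉f (proj₁ (x∈p∩q⁻ f _ u∈I))
      x′∉A₂ : x′ ∉ I ∪ ⁅ b₀ ⁆
      x′∉A₂ x′∈ with ∈-insert⁻ x′∈
      ... | inj₁ x′∈I  = x′∉f (proj₁ (x∈p∩q⁻ f _ x′∈I))
      ... | inj₂ x′≡b₀ = x′≢b₀ x′≡b₀
    ... | no b₀∉g = y₀∉A₂ (g⊆A₂ (maximal-⊆ g-max (proj₁ f-max) g⊆f y₀∈f))
      where
      g⊆f : g ⊆ f
      g⊆f u∈g with ∈-insert⁻ (g⊆A₂ u∈g)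
      ... | inj₁ u∈I  = proj₁ (x∈p∩q⁻ f _ u∈I)
      ... | inj₂ refl = contradiction u∈g b₀∉g
      y₀∉A₂ : y₀ ∉ I ∪ ⁅ b₀ ⁆
      y₀∉A₂ y₀∈ with ∈-insert⁻ y₀∈
      ... | inj₂ refl = b₀∉f y₀∈f
      ... | inj₁ y₀∈I with x∈p∪q⁻ e _ (proj₂ (x∈p∩q⁻ f _ y₀∈I))
      ...   | inj₁ y₀∈e  = y₀∉e y₀∈e
      ...   | inj₂ y₀∈∁N = ~⇒¬≁ b₀~y₀ (∈∁N⁻ y₀∈∁N)

  -- Case 2: no edge joins e ∖ f to f ∖ e; a, b ∈ e ∖ f, c, d ∈ f ∖ e and
  -- b ≁ d.  Move b and d between U = e ∪ f and I = e ∩ f.  A maximal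
  -- clique inside U ─ {b, d} lies in neither e nor f, so it would contain
  -- an edge from e ∖ f to f ∖ e; one inside I ∪ {b, d} misses b or d and
  -- then equals f (missing c) or e (missing a).
  separated-private : Is2Asummable (cliqueHypergraph G) →
                      ∀ {e f a b c d} → IsMaximalClique G e → IsMaximalClique G f →
                      a ∈ e → a ∉ f → b ∈ e → b ∉ f → a ≢ b →
                      c ∈ f → c ∉ e → d ∈ f → d ∉ e → c ≢ d → b ≁ d →
                      (∀ {x y} → x ∈ e → x ∉ f → y ∈ f → y ∉ e → x ≁ y) → ⊥
  separated-private asummable {e} {f} {a} {b} {c} {d} e-max f-max
    a∈e a∉f b∈e b∉f a≢b c∈f c∉e d∈f d∉e c≢d b≁d no-private-edge =
    exchange-contradiction asummable e-max f-max (e ∪ f) (e ∩ f) D (χ-modular e f)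
      D⊆U D∩I=∅ A₁-ind A₂-ind
    where
    D : Subset n
    D = ⁅ b ⁆ ∪ ⁅ d ⁆

    D⊆U : D ⊆ e ∪ f
    D⊆U x∈D with ∈-pair⁻ x∈D
    ... | inj₁ refl = p⊆p∪q f b∈e
    ... | inj₂ refl = q⊆p∪q e f d∈f

    D∩I=∅ : ∀ {x} → x ∈ D → x ∉ e ∩ f
    D∩I=∅ x∈D x∈e∩f with ∈-pair⁻ x∈D | x∈p∩q⁻ e f x∈e∩f
    ... | inj₁ refl | _ , b∈f = b∉f b∈f
    ... | inj₂ refl | d∈e , _ = d∉e d∈e

    A₁-ind : Independent (cliqueHypergraph G) ((e ∪ f) ─ D)
    A₁-ind (g , g-max , g⊆A₁) with ⊆-or-outside g e | ⊆-or-outside g f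
    ... | inj₁ g⊆e | _ =
      x∈p─q⇒x∉q (g⊆A₁ (maximal-⊆ g-max (proj₁ e-max) g⊆e b∈e)) (p⊆p∪q ⁅ d ⁆ (x∈⁅x⁆ b))
    ... | inj₂ _ | inj₁ g⊆f =
      x∈p─q⇒x∉q (g⊆A₁ (maximal-⊆ g-max (proj₁ f-max) g⊆f d∈f)) (∈-insert d)
    ... | inj₂ (y , y∈g , y∉e) | inj₂ (x , x∈g , x∉f) =
      ~⇒¬≁ (member-adjacent g-max x∈g y∈g λ { refl → y∉e x∈e })
           (no-private-edge x∈e x∉f y∈f y∉e)
      where
      in-e∪f : ∀ {z} → z ∈ g → z ∈ e ⊎ z ∈ f
      in-e∪f z∈g = x∈p∪q⁻ e f (p─q⊆p (e ∪ f) D (g⊆A₁ z∈g))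
      x∈e : x ∈ e
      x∈e = [ (λ x∈e → x∈e) , (λ x∈f → contradiction x∈f x∉f) ]′ (in-e∪f x∈g)
      y∈f : y ∈ f
      y∈f = [ (λ y∈e → contradiction y∈e y∉e) , (λ y∈f → y∈f) ]′ (in-e∪f y∈g)

    A₂-ind : Independent (cliqueHypergraph G) ((e ∩ f) ∪ D)
    A₂-ind (g , g-max , g⊆A₂) with d ∈? g | b ∈? g
    ... | yes d∈g | yes b∈g = ~⇒¬≁ (member-adjacent g-max b∈g d∈g λ { refl → d∉e b∈e }) b≁d
    ... | yes d∈g | no b∉g = c∉A₂ (g⊆A₂ (maximal-⊆ g-max (proj₁ f-max) g⊆f c∈f))
      where
      g⊆f : g ⊆ f
      g⊆f u∈g with x∈p∪q⁻ (e ∩ f) D (g⊆A₂ u∈g)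
      ... | inj₁ u∈e∩f = proj₂ (x∈p∩q⁻ e f u∈e∩f)
      ... | inj₂ u∈D with ∈-pair⁻ u∈D
      ...   | inj₁ refl = contradiction u∈g b∉g
      ...   | inj₂ refl = d∈f
      c∉A₂ : c ∉ (e ∩ f) ∪ D
      c∉A₂ c∈ with x∈p∪q⁻ (e ∩ f) D c∈
      ... | inj₁ c∈e∩f = c∉e (proj₁ (x∈p∩q⁻ e f c∈e∩f))
      ... | inj₂ c∈D with ∈-pair⁻ c∈D
      ...   | inj₁ refl = b∉f c∈f
      ...   | inj₂ refl = c≢d refl
    ... | no d∉g | _ = a∉A₂ (g⊆A₂ (maximal-⊆ g-max (proj₁ e-max) g⊆e a∈e))
      where
      g⊆e : g ⊆ e
      g⊆e u∈g with x∈p∪q⁻ (e ∩ f) D (g⊆A₂ u∈g)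
      ... | inj₁ u∈e∩f = proj₁ (x∈p∩q⁻ e f u∈e∩f)
      ... | inj₂ u∈D with ∈-pair⁻ u∈D
      ...   | inj₁ refl = b∈e
      ...   | inj₂ refl = contradiction u∈g d∉g
      a∉A₂ : a ∉ (e ∩ f) ∪ D
      a∉A₂ a∈ with x∈p∪q⁻ (e ∩ f) D a∈
      ... | inj₁ a∈e∩f = a∉f (proj₂ (x∈p∩q⁻ e f a∈e∩f))
      ... | inj₂ a∈D with ∈-pair⁻ a∈D
      ...   | inj₁ refl = a≢b refl
      ...   | inj₂ refl = d∉e a∈e

  private-edge? : ∀ e f → (∃ λ x → ∃ λ y → x ∈ e × x ∉ f × y ∈ f × y ∉ e × x ~ y) ⊎
                          (∀ {x y} → x ∈ e → x ∉ f → y ∈ f → y ∉ e → x ≁ y)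
  private-edge? e f
    with any? (λ x → any? (λ y → x ∈? e ×-dec ¬? (x ∈? f) ×-dec y ∈? f ×-dec ¬? (y ∈? e) ×-dec x ~? y))
  ... | yes (x , y , edge) = inj₁ (x , y , edge)
  ... | no none = inj₂ λ x∈e x∉f y∈f y∉e → ¬-not λ x~y → none (_ , _ , x∈e , x∉f , y∈f , y∉e , x~y)

  2-asummable⇒noAlternatingCycle : Is2Asummable (cliqueHypergraph G) → NoAlternatingCycle
  2-asummable⇒noAlternatingCycle asummable a~b c~d a≁c b≁d a≢c b≢d =
    [ private-edge , no-private-edge ]′ (private-edge? e f)
    where
    open CrossingCliques (crossing-cliques a~b c~d a≁c b≁d a≢c b≢d)
    private-edge : (∃ λ x → ∃ λ y → x ∈ e × x ∉ f × y ∈ f × y ∉ e × x ~ y) → ⊥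
    private-edge (x , y , x∈e , x∉f , y∈f , y∉e , x~y) =
      let x′ , (x′∈e , x′∉f) , x′≢x = avoid {P = λ z → z ∈ e × z ∉ f} (a∈e , a∉f) (b∈e , b∉f) (~⇒≢ a~b) x
      in adjacent-private asummable e-max f-max x∈e x∉f y∈f y∉e x~y x′∈e x′∉f x′≢x
    no-private-edge : (∀ {x y} → x ∈ e → x ∉ f → y ∈ f → y ∉ e → x ≁ y) → ⊥
    no-private-edge = separated-private asummable e-max f-max
      a∈e a∉f b∈e b∉f (~⇒≢ a~b) c∈f c∉e d∈f d∉e (~⇒≢ c~d) b≁d

theorem3p3 : ∀ {n : ℕ} (G : Graph n) →
    (IsThresholdGraph G ⇔ Is1Sperner (cliqueHypergraph G)) ×
    (IsThresholdGraph G ⇔ IsThresholdHypergraph (cliqueHypergraph G)) ×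
    (IsThresholdGraph G ⇔ Is2Asummable (cliqueHypergraph G))
theorem3p3 G =
  mk⇔ (noAlternatingCycle⇒sperner G ∘ threshold⇒noAlternatingCycle G)
      (noAlternatingCycle⇒threshold G ∘ sperner⇒noAlternatingCycle G) ,
  mk⇔ (noAlternatingCycle⇒clique-threshold G ∘ threshold⇒noAlternatingCycle G)
      (noAlternatingCycle⇒threshold G ∘ 2-asummable⇒noAlternatingCycle G ∘ threshold⇒2-asummable _) ,
  mk⇔ (threshold⇒2-asummable _ ∘ noAlternatingCycle⇒clique-threshold G ∘ threshold⇒noAlternatingCycle G)
      (noAlternatingCycle⇒threshold G ∘ 2-asummable⇒noAlternatingCycle G)
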